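{- Let $\mathscr{L}_a=(+,\times,<,0,1)$ be the signature of arithmetic. For every $\mathscr{L}_a$-structure $M$ (with at least two elements), $M\models\exists x\exists y(y\subseteq x\wedge y<x)$ if and only if $<^M$ is not well-founded.
   Context: Formulas of inclusion logic are evaluated in team semantics: a team $X$ of $M$ is a set of assignments with common domain. $M\models_X\alpha$ for first-order $\alpha$ iff $M\models_s\alpha$ for all $s\in X$; $M\models_X y\subseteq x$ iff for every $s\in X$ there is $s'\in X$ with $s(y)=s'(x)$; $M\models_X\phi\wedge\psi$ iff both hold; $M\models_X\exists x\phi$ iff $M\models_{X(F/x)}\phi$ for some $F:X\to\wp(M)\setminus\{\emptyset\}$, where $X(F/x)=\{s(a/x)\mid s\in X,a\in F(s)\}$. For a sentence $\theta$, $M\models\theta$ means $M\models_{\{\emptyset\}}\theta$, where $\{\emptyset\}$ is the team containing only the empty assignment. -}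

module Defs where

open import Data.Nat using (ℕ; zero; suc)
open import Data.Fin using (Fin; zero; suc)
open import Data.Vec using (Vec; []; _∷_; map)
open import Data.Product using (Σ; Σ-syntax; ∃; _×_; _,_)
open import Data.Sum using (_⊎_)
open import Data.Unit using (⊤)
open import Data.Empty using (⊥)
open import Relation.Nullary using (¬_)
open import Relation.Binary.PropositionalEquality using (_≡_)
open import Level using (Lift; 0ℓ) renaming (suc to lsuc)

record LaStructure : Set₁ where
  field
    Carrier : Set
    _⊕_     : Carrier → Carrier → Carrier
    _⊗_     : Carrier → Carrier → Carrier
    _≺_     : Carrier → Carrier → Set
    𝟘       : Carrier
    𝟙       : Carrier

-- Terms and first-order formulas with n free variables (de Bruijn: the most
-- recently bound variable is index zero).
data Term (n : ℕ) : Set where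
  var  : Fin n → Term n
  zer  : Term n
  one  : Term n
  plus : Term n → Term n → Term n
  mult : Term n → Term n → Term n

data FO : ℕ → Set where
  eq   : ∀ {n} → Term n → Term n → FO n
  lt   : ∀ {n} → Term n → Term n → FO n
  neg  : ∀ {n} → FO n → FO n
  conj : ∀ {n} → FO n → FO n → FO n
  disj : ∀ {n} → FO n → FO n → FO n
  ex   : ∀ {n} → FO (suc n) → FO n
  all  : ∀ {n} → FO (suc n) → FO n

data IncForm : ℕ → Set where
  fo   : ∀ {n} → FO n → IncForm n
  incl : ∀ {n k} → Vec (Fin n) k → Vec (Fin n) k → IncForm n   -- incl ys xs  is  ys ⊆ xs
  and  : ∀ {n} → IncForm n → IncForm n → IncForm n
  exi  : ∀ {n} → IncForm (suc n) → IncForm n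

module Semantics (M : LaStructure) where
  open LaStructure M

  Assignment : ℕ → Set
  Assignment n = Fin n → Carrier

  extend : ∀ {n} → Assignment n → Carrier → Assignment (suc n)
  extend s a zero    = a
  extend s a (suc i) = s i

  evalT : ∀ {n} → Term n → Assignment n → Carrier
  evalT (var i)    s = s i
  evalT zer        s = 𝟘
  evalT one        s = 𝟙
  evalT (plus t u) s = evalT t s ⊕ evalT u s
  evalT (mult t u) s = evalT t s ⊗ evalT u s

  SatFO : ∀ {n} → FO n → Assignment n → Set
  SatFO (eq t u)   s = evalT t s ≡ evalT u s
  SatFO (lt t u)   s = evalT t s ≺ evalT u s
  SatFO (neg α)    s = ¬ SatFO α s
  SatFO (conj α β) s = SatFO α s × SatFO β s
  SatFO (disj α β) s = SatFO α s ⊎ SatFO β s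
  SatFO (ex α)     s = Σ[ a ∈ Carrier ] SatFO α (extend s a)
  SatFO (all α)    s = (a : Carrier) → SatFO α (extend s a)

  Team : ℕ → Set₁
  Team n = Assignment n → Set

  -- X(F/x) = { s(a/x) | s ∈ X, a ∈ F(s) }  (membership up to pointwise equality)
  supplement : ∀ {n} → Team n → (Assignment n → Carrier → Set) → Team (suc n)
  supplement X F t =
    Σ[ s ∈ Assignment _ ] (X s × Σ[ a ∈ Carrier ] (F s a × (∀ i → t i ≡ extend s a i)))

  Sat : ∀ {n} → IncForm n → Team n → Set₁
  Sat (fo α)       X = Lift (lsuc 0ℓ) (∀ s → X s → SatFO α s)
  Sat (incl ys xs) X = Lift (lsuc 0ℓ) (∀ s → X s → Σ[ s' ∈ Assignment _ ] (X s' × map s ys ≡ map s' xs))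
  Sat (and φ ψ)    X = Sat φ X × Sat ψ X
  -- ∃x φ: some F : X → ℘(M) \ {∅} with M ⊨_{X(F/x)} φ
  Sat (exi φ)      X =
    Σ[ F ∈ (Assignment _ → Carrier → Set) ]
      ((∀ s → X s → Σ[ a ∈ Carrier ] F s a) × Sat φ (supplement X F))

  -- the team {∅} containing only the empty assignment
  emptyTeam : Team 0
  emptyTeam _ = ⊤

_⊨_ : (M : LaStructure) → IncForm 0 → Set₁
M ⊨ θ = Semantics.Sat M θ (Semantics.emptyTeam M)

-- The sentence ∃x ∃y (y ⊆ x ∧ y < x).  Under ∃x ∃y, y is index zero and x is index one.
descSentence : IncForm 0
descSentence =
  exi (exi (and (incl (zero ∷ []) (suc zero ∷ []))
                (fo (lt (var zero) (var (suc zero))))))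

-- y ⊆ x ∧ y < x says that every value of y in the final team is again a value of
-- x, and lies below the x-value it is paired with. So the values of x form a
-- nonempty set without a <-minimal element, which cannot consist of accessible
-- elements. Conversely, classically the inaccessible elements form such a set
-- whenever < is not well-founded; choosing x among them and y below x among them
-- satisfies the sentence.
module Submission where

open import Defs
open import Data.Product using (Σ-syntax)
open import Relation.Nullary using (¬_)
open import Relation.Binary.PropositionalEquality using (_≢_)
open import Induction.WellFounded using (WellFounded)
open import Axiom.ExcludedMiddle using (ExcludedMiddle)
open import Function.Bundles using (_⇔_)
open import Level using (0ℓ)

open import Data.Nat as ℕ using ()
open import Data.Fin using (zero; suc)
open import Data.Vec using ([]; _∷_)
open import Data.Vec.Properties using (∷-injectiveˡ)
open import Data.Product using (Σ; _×_; _,_; proj₁; proj₂)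
open import Data.Unit using (tt)
open import Relation.Binary using (Rel)
open import Relation.Binary.PropositionalEquality using (_≡_; refl; sym; cong; subst; subst₂)
open import Relation.Nullary.Negation using (¬∃⟶∀¬)
open import Induction.WellFounded using (Acc; acc)
open import Axiom.DoubleNegationElimination using (DoubleNegationElimination; em⇒dne)
open import Level using (lift)
open import Function.Bundles using (mk⇔)

NoMinimal : {A : Set} → Rel A 0ℓ → (A → Set) → Set
NoMinimal {A} _<_ P = ∀ {a} → P a → Σ[ b ∈ A ] (P b × b < a)

module _ {A : Set} {_<_ : Rel A 0ℓ} where

  noMinimal⇒¬acc : ∀ {P} → NoMinimal _<_ P → ∀ {a} → P a → ¬ Acc _<_ a
  noMinimal⇒¬acc noMin Pa (acc rs) with noMin Pa
  ... | _ , Pb , b<a = noMinimal⇒¬acc noMin Pb (rs b<a)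

  noMinimal⇒¬wf : ∀ {P} → Σ A P → NoMinimal _<_ P → ¬ WellFounded _<_
  noMinimal⇒¬wf (a , Pa) noMin wf = noMinimal⇒¬acc noMin Pa (wf a)

  module _ (dne : DoubleNegationElimination 0ℓ) where

    ¬wf⇒∃¬acc : ¬ WellFounded _<_ → Σ[ a ∈ A ] ¬ Acc _<_ a
    ¬wf⇒∃¬acc ¬wf = dne λ ∄¬acc → ¬wf λ a → dne (¬∃⟶∀¬ ∄¬acc a)

    ¬acc-noMinimal : NoMinimal _<_ (λ a → ¬ Acc _<_ a)
    ¬acc-noMinimal ¬acc = dne λ ∄smaller →
      ¬acc (acc λ {b} b<a → dne λ ¬acc-b → ∄smaller (b , ¬acc-b , b<a))

module _ (M : LaStructure) where
  open LaStructure M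
  open Semantics M

  emptyAssignment : Assignment 0
  emptyAssignment ()

  supplement-extend : ∀ {n} {X : Team n} {F s a} → X s → F s a → supplement X F (extend s a)
  supplement-extend {s = s} {a} s∈X a∈Fs = s , s∈X , a , a∈Fs , λ _ → refl

  supplement-nonempty : ∀ {n} {X : Team n} {F} → (∀ s → X s → Σ[ a ∈ Carrier ] F s a) →
                        Σ[ s ∈ Assignment n ] X s → Σ[ t ∈ Assignment (ℕ.suc n) ] supplement X F t
  supplement-nonempty F-nonempty (s , s∈X) with F-nonempty s s∈X
  ... | a , a∈Fs = extend s a , supplement-extend s∈X a∈Fs

  xyTeam : (Assignment 0 → Carrier → Set) → (Assignment 1 → Carrier → Set) → Team 2
  xyTeam F G = supplement (supplement emptyTeam F) G

  ⊨descSentence⇒noMinimal : M ⊨ descSentence →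
                            Σ[ P ∈ (Carrier → Set) ] (Σ Carrier P × NoMinimal _≺_ P)
  ⊨descSentence⇒noMinimal (F , F-nonempty , G , G-nonempty , lift y⊆x , lift y<x) =
    xValue , (_ , proj₁ inhabited , proj₂ inhabited , refl) , xValue-noMinimal
    where
    xValue : Carrier → Set
    xValue a = Σ[ t ∈ Assignment 2 ] (xyTeam F G t × t (suc zero) ≡ a)

    inhabited : Σ[ t ∈ Assignment 2 ] xyTeam F G t
    inhabited = supplement-nonempty G-nonempty
                  (supplement-nonempty F-nonempty (emptyAssignment , tt))

    xValue-noMinimal : NoMinimal _≺_ xValue
    xValue-noMinimal (t , t∈xy , refl) with y⊆x t t∈xy
    ... | t′ , t′∈xy , y≡x′ = t zero , (t′ , t′∈xy , sym (∷-injectiveˡ y≡x′)) , y<x t t∈xy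

  noMinimal⇒⊨descSentence : ∀ {P} → Σ Carrier P → NoMinimal _≺_ P → M ⊨ descSentence
  noMinimal⇒⊨descSentence {P} (a , Pa) noMin =
    F , (λ _ _ → a , Pa) , G , G-nonempty , lift y⊆x , lift y<x
    where
    F : Assignment 0 → Carrier → Set
    F _ = P

    G : Assignment 1 → Carrier → Set
    G s b = P b × b ≺ s zero

    G-nonempty : ∀ s → supplement emptyTeam F s → Σ[ b ∈ Carrier ] G s b
    G-nonempty s (_ , _ , a , Pa , s≡) = noMin (subst P (sym (s≡ zero)) Pa)

    y<x : ∀ t → xyTeam F G t → t zero ≺ t (suc zero)
    y<x t (_ , _ , _ , (_ , b<x) , t≡) = subst₂ _≺_ (sym (t≡ zero)) (sym (t≡ (suc zero))) b<x

    y⊆x : ∀ t → xyTeam F G t →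
          Σ[ t′ ∈ Assignment 2 ] (xyTeam F G t′ × t zero ∷ [] ≡ t′ (suc zero) ∷ [])
    y⊆x t (_ , _ , b , (Pb , _) , t≡) with noMin Pb
    ... | c , c∈Gb =
      extend (extend emptyAssignment b) c ,
      supplement-extend (supplement-extend tt Pb) c∈Gb ,
      cong (_∷ []) (t≡ zero)

mainTheorem3 : ExcludedMiddle 0ℓ → (M : LaStructure) →
    (Σ[ a ∈ LaStructure.Carrier M ] Σ[ b ∈ LaStructure.Carrier M ] (a ≢ b)) →
    (M ⊨ descSentence) ⇔ (¬ WellFounded (LaStructure._≺_ M))
mainTheorem3 em M _ = mk⇔ sat⇒¬wf ¬wf⇒sat
  where
  dne = em⇒dne em

  sat⇒¬wf : M ⊨ descSentence → ¬ WellFounded (LaStructure._≺_ M)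
  sat⇒¬wf sat with ⊨descSentence⇒noMinimal M sat
  ... | _ , nonempty , noMin = noMinimal⇒¬wf nonempty noMin

  ¬wf⇒sat : ¬ WellFounded (LaStructure._≺_ M) → M ⊨ descSentence
  ¬wf⇒sat ¬wf = noMinimal⇒⊨descSentence M (¬wf⇒∃¬acc dne ¬wf) (¬acc-noMinimal dne)
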